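{- Let $\lambda,\mu$ be strict partitions with $\mu\subseteq\lambda$, and let $\mathcal{C},\mathcal{C}'$ be configurations for $\lambda/\mu$ such that $\mathcal{C}'$ is obtained from $\mathcal{C}$ by exchanging the $0$'s of two rows $a$ and $b$, where either (i) in $\mathcal{C}$ rows $a,b$ have types $(e,o),(o,o)$ and in $\mathcal{C}'$ they have types $(o,e),(e,\emptyset)$; or (ii) in $\mathcal{C}$ rows $a,b$ have types $(o,o),(e,o)$ and in $\mathcal{C}'$ they have types $(e,e),(o,\emptyset)$. Then $\kappa(\mathcal{C}')=\kappa(\mathcal{C})$.
   Context: Let $S(\lambda)$ be the shifted diagram of $\lambda$ (row $i$ of the Young diagram shifted $i-1$ squares right). A configuration $\mathcal{C}$ of $0$'s for $\lambda/\mu$ assigns to each row $i$ an integer $z_i$ with $0\le z_i\le\lambda_i$ (the leftmost $z_i$ squares of row $i$ are filled with $0$, the other $\lambda_i-z_i$ squares are blank), such that the nonzero $z_i$'s, arranged in decreasing order, are exactly the parts of $\mu$. Exchanging the $0$'s of rows $a\ne b$ means replacing $(z_a,z_b)$ by $(z_b,z_a)$ (when this is again a configuration). Row types: $(e,e)$: $z_i>0$ even and $\lambda_i-z_i>0$ even; $(e,o)$: $z_i>0$ even, $\lambda_i-z_i$ odd; $(o,e)$: $z_i$ odd, $\lambda_i-z_i>0$ even; $(o,o)$: $z_i$ odd, $\lambda_i-z_i$ odd; $(\emptyset,e)$: $z_i=0$, $\lambda_i$ even; $(\emptyset,o)$: $z_i=0$, $\lambda_i$ odd; $(e,\emptyset)$: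 $z_i=\lambda_i$ even; $(o,\emptyset)$: $z_i=\lambda_i$ odd. Let $o_r$ (resp. $e_r$) be the number of rows with $z_i=0$ and $\lambda_i$ odd (resp. even), and $o_s$ (resp. $e_s$) the number of rows with $z_i>0$ and $\lambda_i-z_i$ odd (resp. even and nonzero). Define $\kappa(\mathcal{C})=o_s+2e_s+\max\big(o_r,\ e_r+((e_r+o_r)\bmod 2)\big)$. -}

module Defs where

open import Data.Nat using (ℕ; zero; suc; _+_; _*_; _∸_; _≤_; _<_; _>_; _⊔_; _%_)
open import Data.Nat.Divisibility using (_∣_; _∣?_)
open import Data.Nat.Properties using (_≟_)
open import Data.Fin using (Fin)
open import Data.Vec using (Vec; lookup; toList; _[_]≔_)
open import Data.List using (List; []; _∷_; filter)
open import Data.List.Relation.Unary.All using (All)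
open import Data.List.Relation.Unary.Linked using (Linked)
open import Data.List.Relation.Binary.Permutation.Propositional using (_↭_)
open import Data.Product using (_×_)
open import Data.Unit using (⊤)
open import Data.Empty using (⊥)
open import Relation.Nullary using (¬_; does; ¬?)
open import Relation.Nullary.Decidable using (⌊_⌋)
open import Data.Bool using (Bool; true; false; _∧_; not; if_then_else_)
open import Relation.Binary.PropositionalEquality using (_≡_)

StrictPartition : List ℕ → Set
StrictPartition p = All (λ x → 0 < x) p × Linked _>_ p

_⊆P_ : List ℕ → List ℕ → Set
[] ⊆P _ = ⊤
(m ∷ ms) ⊆P [] = ⊥
(m ∷ ms) ⊆P (l ∷ ls) = (m ≤ l) × (ms ⊆P ls)

nonzeros : List ℕ → List ℕ
nonzeros = filter (λ x → ¬? (x ≟ 0))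

-- A configuration of 0's for λ/μ: z_i ≤ λ_i for each row i, and the
-- nonzero z_i's, arranged in decreasing order, are exactly the parts of μ
-- (μ is strictly decreasing, so this is: nonzero z's form a permutation of μ).
Config : {n : ℕ} → Vec ℕ n → List ℕ → Vec ℕ n → Set
Config {n} lam mu z = ((i : Fin n) → lookup z i ≤ lookup lam i) × (nonzeros (toList z) ↭ mu)

exchange : {n : ℕ} → Vec ℕ n → Fin n → Fin n → Vec ℕ n
exchange z a b = (z [ a ]≔ lookup z b) [ b ]≔ lookup z a

Even : ℕ → Set
Even n = 2 ∣ n

Odd : ℕ → Set
Odd n = ¬ (2 ∣ n)

-- Row types, for a row of length l with z zeros (z ≤ l).
data RowType : Set where
  ee eo oe oo ∅e ∅o e∅ o∅ : RowType

HasType : ℕ → ℕ → RowType → Set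
HasType l z ee = (0 < z) × Even z × (0 < l ∸ z) × Even (l ∸ z)
HasType l z eo = (0 < z) × Even z × Odd (l ∸ z)
HasType l z oe = Odd z × (0 < l ∸ z) × Even (l ∸ z)
HasType l z oo = Odd z × Odd (l ∸ z)
HasType l z ∅e = (z ≡ 0) × Even l
HasType l z ∅o = (z ≡ 0) × Odd l
HasType l z e∅ = (0 < z) × (z ≡ l) × Even z
HasType l z o∅ = (z ≡ l) × Odd z

count : {n : ℕ} → (ℕ → ℕ → Bool) → Vec ℕ n → Vec ℕ n → ℕ
count t lam z = go (toList lam) (toList z)
  where
  go : List ℕ → List ℕ → ℕ
  go (l ∷ ls) (x ∷ xs) = (if t l x then 1 else 0) + go ls xs
  go _ _ = 0

isEvenB : ℕ → Bool
isEvenB k = ⌊ 2 ∣? k ⌋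

isZeroB : ℕ → Bool
isZeroB k = ⌊ k ≟ 0 ⌋

o-r e-r o-s e-s : {n : ℕ} → Vec ℕ n → Vec ℕ n → ℕ
o-r = count (λ l x → isZeroB x ∧ not (isEvenB l))
e-r = count (λ l x → isZeroB x ∧ isEvenB l)
o-s = count (λ l x → not (isZeroB x) ∧ not (isEvenB (l ∸ x)))
e-s = count (λ l x → not (isZeroB x) ∧ (isEvenB (l ∸ x) ∧ not (isZeroB (l ∸ x))))

κ : {n : ℕ} → Vec ℕ n → Vec ℕ n → ℕ
κ lam z = o-s lam z + 2 * e-s lam z
        + (o-r lam z ⊔ (e-r lam z + ((e-r lam z + o-r lam z) % 2)))

-- Rows of type (e,o) and (o,o) each count once in o_s; after the exchange row a,
-- of type (o,e) or (e,e), counts once in e_s, and row b, now completely filled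
-- with 0's, counts nowhere. No row enters or leaves o_r or e_r, so o_s drops by 2
-- while 2 e_s rises by 2, and κ is unchanged.
module Submission where

open import Defs
open import Data.Bool using (Bool; true; false; _∧_; not; if_then_else_)
open import Data.Empty using (⊥-elim)
open import Data.Fin using (Fin; zero; suc)
open import Data.List using (List)
open import Data.Nat using (ℕ; zero; suc; _+_; _*_; _∸_; _<_; _⊔_; _%_; s≤s; z≤n)
open import Data.Nat.Divisibility using (_∣?_; divides)
open import Data.Nat.Properties using (+-assoc; +-identityʳ; n∸n≡0; +-commutativeSemigroup)
open import Algebra.Properties.CommutativeSemigroup +-commutativeSemigroup
  using (x∙yz≈xz∙y; xy∙z≈xz∙y; xy∙z≈zy∙x)
open import Data.Nat.Tactic.RingSolver using (solve-∀)
open import Data.Product using (_×_; _,_)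
open import Data.Sum using (_⊎_; inj₁; inj₂)
open import Data.Vec using (Vec; _∷_; lookup; toList; _[_]≔_)
open import Data.Vec.Properties using (lookup∘update; lookup∘update′)
open import Relation.Nullary using (yes; no)
open import Relation.Binary.PropositionalEquality
  using (_≡_; _≢_; ≢-sym; refl; sym; trans; cong; module ≡-Reasoning)

indicator : (ℕ → ℕ → Bool) → ℕ → ℕ → ℕ
indicator t l x = if t l x then 1 else 0

count-update : ∀ t {n} (lam z : Vec ℕ n) (i : Fin n) v →
  count t lam (z [ i ]≔ v) + indicator t (lookup lam i) (lookup z i)
    ≡ count t lam z + indicator t (lookup lam i) v
count-update t (l ∷ lam) (x ∷ z) zero v = xy∙z≈zy∙x (indicator t l v) _ _
count-update t (l ∷ lam) (x ∷ z) (suc i) v = begin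
  (indicator t l x + count t lam (z [ i ]≔ v)) + _ ≡⟨ +-assoc (indicator t l x) _ _ ⟩
  indicator t l x + (count t lam (z [ i ]≔ v) + _) ≡⟨ cong (indicator t l x +_) (count-update t lam z i v) ⟩
  indicator t l x + (count t lam z + _)            ≡⟨ sym (+-assoc (indicator t l x) _ _) ⟩
  (indicator t l x + count t lam z) + _            ∎
  where open ≡-Reasoning

lookup-exchange-left : ∀ {n} (z : Vec ℕ n) {a b : Fin n} → a ≢ b →
  lookup (exchange z a b) a ≡ lookup z b
lookup-exchange-left z {a} {b} a≢b =
  trans (lookup∘update′ a≢b (z [ a ]≔ lookup z b) _) (lookup∘update a z _)

lookup-exchange-right : ∀ {n} (z : Vec ℕ n) (a b : Fin n) →
  lookup (exchange z a b) b ≡ lookup z a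
lookup-exchange-right z a b = lookup∘update b (z [ a ]≔ lookup z b) _

count-exchange : ∀ t {n} (lam z : Vec ℕ n) {a b : Fin n} (a≢b : a ≢ b) →
  let la = lookup lam a ; lb = lookup lam b ; z' = exchange z a b in
  count t lam z' + (indicator t la (lookup z a) + indicator t lb (lookup z b))
    ≡ count t lam z + (indicator t la (lookup z' a) + indicator t lb (lookup z' b))
count-exchange t lam z {a} {b} a≢b
  rewrite lookup-exchange-left z a≢b | lookup-exchange-right z a b = begin
    c' + (A + B)   ≡⟨ x∙yz≈xz∙y c' A B ⟩
    (c' + B) + A   ≡⟨ cong (_+ A) updateAtB ⟩
    (c₁ + B') + A  ≡⟨ xy∙z≈xz∙y c₁ B' A ⟩
    (c₁ + A) + B'  ≡⟨ cong (_+ B') (count-update t lam z a (lookup z b)) ⟩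
    (c + A') + B'  ≡⟨ +-assoc c A' B' ⟩
    c + (A' + B')  ∎
  where
  open ≡-Reasoning
  z₁ : Vec ℕ _
  z₁ = z [ a ]≔ lookup z b
  c c₁ c' A B A' B' : ℕ
  c = count t lam z
  c₁ = count t lam z₁
  c' = count t lam (exchange z a b)
  A = indicator t (lookup lam a) (lookup z a)
  B = indicator t (lookup lam b) (lookup z b)
  A' = indicator t (lookup lam a) (lookup z b)
  B' = indicator t (lookup lam b) (lookup z a)
  updateAtB : c' + B ≡ c₁ + B'
  updateAtB = trans (cong (λ w → c' + indicator t (lookup lam b) w)
                          (sym (lookup∘update′ (≢-sym a≢b) z _)))
                    (count-update t lam z₁ b (lookup z a))

-- The row tests of o-r, e-r, o-s and e-s, so that e.g. count o-s-row is o-s by definition.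
o-r-row e-r-row o-s-row e-s-row : ℕ → ℕ → Bool
o-r-row l x = isZeroB x ∧ not (isEvenB l)
e-r-row l x = isZeroB x ∧ isEvenB l
o-s-row l x = not (isZeroB x) ∧ not (isEvenB (l ∸ x))
e-s-row l x = not (isZeroB x) ∧ (isEvenB (l ∸ x) ∧ not (isZeroB (l ∸ x)))

Contributions : (l x o-r′ e-r′ o-s′ e-s′ : ℕ) → Set
Contributions l x o-r′ e-r′ o-s′ e-s′ =
  (indicator o-r-row l x ≡ o-r′) × (indicator e-r-row l x ≡ e-r′)
    × (indicator o-s-row l x ≡ o-s′) × (indicator e-s-row l x ≡ e-s′)

isZeroB-pos : ∀ {x} → 0 < x → isZeroB x ≡ false
isZeroB-pos {suc _} _ = refl

isEvenB-even : ∀ {k} → Even k → isEvenB k ≡ true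
isEvenB-even {k} e with 2 ∣? k
... | yes _ = refl
... | no ¬e = ⊥-elim (¬e e)

isEvenB-odd : ∀ {k} → Odd k → isEvenB k ≡ false
isEvenB-odd {k} o with 2 ∣? k
... | yes e = ⊥-elim (o e)
... | no _ = refl

odd⇒pos : ∀ {x} → Odd x → 0 < x
odd⇒pos {zero} o = ⊥-elim (o (divides 0 refl))
odd⇒pos {suc _} _ = s≤s z≤n

contributions-oddRest : ∀ {l x} → 0 < x → Odd (l ∸ x) → Contributions l x 0 0 1 0
contributions-oddRest p o rewrite isZeroB-pos p | isEvenB-odd o =
  refl , refl , refl , refl

contributions-evenRest : ∀ {l x} → 0 < x → 0 < l ∸ x → Even (l ∸ x) → Contributions l x 0 0 0 1
contributions-evenRest p q e rewrite isZeroB-pos p | isEvenB-even e | isZeroB-pos q =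
  refl , refl , refl , refl

contributions-full : ∀ {x} → 0 < x → Contributions x x 0 0 0 0
contributions-full {x} p rewrite isZeroB-pos p | n∸n≡0 x = refl , refl , refl , refl

module _ {l x : ℕ} where

  contributions-eo : HasType l x eo → Contributions l x 0 0 1 0
  contributions-eo (p , _ , o) = contributions-oddRest p o

  contributions-oo : HasType l x oo → Contributions l x 0 0 1 0
  contributions-oo (o , o′) = contributions-oddRest (odd⇒pos o) o′

  contributions-oe : HasType l x oe → Contributions l x 0 0 0 1
  contributions-oe (o , q , e) = contributions-evenRest (odd⇒pos o) q e

  contributions-ee : HasType l x ee → Contributions l x 0 0 0 1
  contributions-ee (p , _ , q , e) = contributions-evenRest p q e

  contributions-e∅ : HasType l x e∅ → Contributions l x 0 0 0 0
  contributions-e∅ (p , refl , _) = contributions-full p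

  contributions-o∅ : HasType l x o∅ → Contributions l x 0 0 0 0
  contributions-o∅ (refl , o) = contributions-full (odd⇒pos o)

count-exchange-by : ∀ t {n} (lam z : Vec ℕ n) {a b : Fin n} → a ≢ b → ∀ {i j i' j'} →
  indicator t (lookup lam a) (lookup z a) ≡ i →
  indicator t (lookup lam b) (lookup z b) ≡ j →
  indicator t (lookup lam a) (lookup (exchange z a b) a) ≡ i' →
  indicator t (lookup lam b) (lookup (exchange z a b) b) ≡ j' →
  count t lam (exchange z a b) + (i + j) ≡ count t lam z + (i' + j')
count-exchange-by t lam z a≢b refl refl refl refl = count-exchange t lam z a≢b

κ-preserved : ∀ {n} (lam z z' : Vec ℕ n) →
  o-s lam z ≡ o-s lam z' + 2 → e-s lam z' ≡ e-s lam z + 1 →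
  o-r lam z' ≡ o-r lam z → e-r lam z' ≡ e-r lam z → κ lam z' ≡ κ lam z
κ-preserved lam z z' = arithmetic
  where
  shift : ∀ p q m → p + 2 * (q + 1) + m ≡ p + 2 + 2 * q + m
  shift = solve-∀
  arithmetic : ∀ {s s' t t' r r' e e'} → s ≡ s' + 2 → t' ≡ t + 1 → r' ≡ r → e' ≡ e →
    s' + 2 * t' + (r' ⊔ (e' + (e' + r') % 2)) ≡ s + 2 * t + (r ⊔ (e + (e + r) % 2))
  arithmetic {s' = s'} {t} {r = r} {e = e} refl refl refl refl = shift s' t (r ⊔ (e + (e + r) % 2))

κ-exchange : ∀ {n} (lam z : Vec ℕ n) {a b : Fin n} → a ≢ b →
  Contributions (lookup lam a) (lookup z a) 0 0 1 0 →
  Contributions (lookup lam b) (lookup z b) 0 0 1 0 →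
  Contributions (lookup lam a) (lookup (exchange z a b) a) 0 0 0 1 →
  Contributions (lookup lam b) (lookup (exchange z a b) b) 0 0 0 0 →
  κ lam (exchange z a b) ≡ κ lam z
κ-exchange lam z a≢b
  (ar₁ , ar₂ , as₁ , as₂) (br₁ , br₂ , bs₁ , bs₂)
  (ar₁' , ar₂' , as₁' , as₂') (br₁' , br₂' , bs₁' , bs₂') =
  κ-preserved lam z _
    (sym (trans (count-exchange-by o-s-row lam z a≢b as₁ bs₁ as₁' bs₁') (+-identityʳ _)))
    (trans (sym (+-identityʳ _)) (count-exchange-by e-s-row lam z a≢b as₂ bs₂ as₂' bs₂'))
    (unchanged (count-exchange-by o-r-row lam z a≢b ar₁ br₁ ar₁' br₁'))
    (unchanged (count-exchange-by e-r-row lam z a≢b ar₂ br₂ ar₂' br₂'))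
  where
  unchanged : ∀ {m m'} → m' + 0 ≡ m + 0 → m' ≡ m
  unchanged {m} {m'} h = trans (sym (+-identityʳ m')) (trans h (+-identityʳ m))

mainTheorem11 : (n : ℕ) (lam : Vec ℕ n) (mu : List ℕ)
    → StrictPartition (toList lam) → StrictPartition mu → mu ⊆P toList lam
    → (z z' : Vec ℕ n) → Config lam mu z → Config lam mu z'
    → (a b : Fin n) → a ≢ b → z' ≡ exchange z a b
    → ((HasType (lookup lam a) (lookup z a) eo × HasType (lookup lam b) (lookup z b) oo
        × HasType (lookup lam a) (lookup z' a) oe × HasType (lookup lam b) (lookup z' b) e∅)
      ⊎ (HasType (lookup lam a) (lookup z a) oo × HasType (lookup lam b) (lookup z b) eo
        × HasType (lookup lam a) (lookup z' a) ee × HasType (lookup lam b) (lookup z' b) o∅))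
    → κ lam z' ≡ κ lam z
mainTheorem11 _ lam _ _ _ _ z _ _ _ _ _ a≢b refl (inj₁ (ta , tb , ta' , tb')) =
  κ-exchange lam z a≢b (contributions-eo ta) (contributions-oo tb)
    (contributions-oe ta') (contributions-e∅ tb')
mainTheorem11 _ lam _ _ _ _ z _ _ _ _ _ a≢b refl (inj₂ (ta , tb , ta' , tb')) =
  κ-exchange lam z a≢b (contributions-oo ta) (contributions-eo tb)
    (contributions-ee ta') (contributions-o∅ tb')
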